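{- (1) $1\#\neq 1\mathrm{Gap}_{\geq0}$. (2) $1\mathrm{F}_{\mathbb Z}\neq 1\mathrm{Gap}$.
   Context: A one-way nondeterministic finite automaton (1nfa) is $M=(Q,\Sigma,\{\rhd,\lhd\},\delta,q_0,Q_{acc},Q_{rej})$: finite state set $Q$, input alphabet $\Sigma$, endmarkers $\rhd,\lhd\notin\Sigma$, disjoint sets $Q_{acc},Q_{rej}\subseteq Q$ ($Q_{halt}=Q_{acc}\cup Q_{rej}$), transition function $\delta:(Q-Q_{halt})\times(\Sigma\cup\{\rhd,\lhd\})\to\mathcal P(Q)$. On input $x$ it reads $\rhd x\lhd$ left to right, moving its head one cell right at every step (no $\lambda$-moves), halting on entering a halting state. A path is accepting (resp. rejecting) if it enters $Q_{acc}$ (resp. $Q_{rej}$), otherwise neither. $\#M(x)$, $\#\overline{M}(x)$ are the numbers of accepting and rejecting paths on $x$. A one-way deterministic finite transducer (1dft) has a deterministic transition function $\delta:Q\times(\Sigma\cup\{\rhd,\lhd\})\to Q\times\Gamma^*$, moves its input head right at each step and writes the given string on a write-once output tape. A family of automata/transducers $\{M_n\}_{n\in\mathbb N}$ has polynomial size if $|Q_n|\le p(n)$ for a fixed polynomial $p$. A family of partial functions over a fixed alphabet $\Sigma$ is $\{(f_n,D_n)\}_{n\in\mathbb N}$ with $f_n$ defined on $D_n\subseteq\Sigma^*$. $1\#$ (resp. $1\mathrm{Gap}$) is the class of such families for which a polynomial-size family of 1nfa's satisfies $f_n(x)=\#M_n(x)$ (resp. $f_n(x)=\#M_n(x)-\#\overline{M}_n(x)$)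 for all $n$ and $x\in D_n$. $1\mathrm{Gap}_{\ge0}$ consists of the families in $1\mathrm{Gap}$ with $f_n(x)\ge0$ for all $n$ and $x\in D_n$. $1\mathrm F$ is the class of families $\{(f_n,D_n)\}$ ($f_n:\Sigma^*\to\Gamma^*$ partial) computed by polynomial-size families of 1dft's, i.e. $M_n$ on every $x\in D_n$ writes $f_n(x)$ on its output tape. For an integer $k$: $trans(0)=\lambda$, $trans(k)=1\,bin(k)$ for $k>0$, $trans(-k)=0\,bin(k)$ for $k>0$, where $bin(k)$ is the binary representation of $k$ with leading 1. $1\mathrm F_{\mathbb Z}$ is the class of families $\{(f_n,D_n)\}$ of partial functions $\Sigma^*\to\mathbb Z$ such that $\{(trans\circ f_n,D_n)\}\in 1\mathrm F$. -}

module Defs where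

open import Data.Nat using (ℕ; zero; suc; _+_; _*_; _^_; _≤_; _≡ᵇ_)
open import Data.Nat.DivMod using (_/_; _%_)
open import Data.Nat.ListAction using (sum)
open import Data.Integer using (ℤ; +_; -[1+_]; _-_; _≥_)
open import Data.Bool using (Bool; true; false; if_then_else_)
open import Data.Fin using (Fin)
open import Data.List using (List; []; _∷_; _++_; map; reverse; allFin; [_])
open import Data.Product using (Σ; ∃; _×_; _,_; proj₁; proj₂)
open import Relation.Binary.PropositionalEquality using (_≡_)
open import Level using (0ℓ)

-- Tape symbols: input alphabet Σ = Fin k plus the two endmarkers.

data Sym (k : ℕ) : Set where
  ▹   : Sym k
  ◃   : Sym k
  sym : Fin k → Sym k

tape : {k : ℕ} → List (Fin k) → List (Sym k)
tape x = ▹ ∷ (map sym x ++ [ ◃ ])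

evalPoly : List ℕ → ℕ → ℕ
evalPoly []       n = 0
evalPoly (c ∷ cs) n = c + n * evalPoly cs n

PolyBounded : (ℕ → ℕ) → Set
PolyBounded s = ∃ λ (p : List ℕ) → ∀ n → s n ≤ evalPoly p n

-- Each state is accepting, rejecting or non-halting
-- (so Q_acc and Q_rej are disjoint by construction).
-- δ q a is a subset of Q (as a characteristic function); it is only
-- consulted for non-halting states q.

data Kind : Set where
  acc rej run : Kind

record NFA (k s : ℕ) : Set where
  field
    kind : Fin s → Kind
    δ    : Fin s → Sym k → Fin s → Bool
    q₀   : Fin s

countPaths : {k s : ℕ} → NFA k s → Kind → Fin s → List (Sym k) → ℕ
countPaths M target q w with NFA.kind M q
countPaths M acc q w | acc = 1
countPaths M acc q w | rej = 0
countPaths M rej q w | acc = 0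
countPaths M rej q w | rej = 1
countPaths M run q w | acc = 0
countPaths M run q w | rej = 0
countPaths M target q [] | run = 0
countPaths M target q (a ∷ w) | run =
  sum (map (λ q' → if NFA.δ M q a q' then countPaths M target q' w else 0)
           (allFin _))

#acc : {k s : ℕ} → NFA k s → List (Fin k) → ℕ
#acc M x = countPaths M acc (NFA.q₀ M) (tape x)

#rej : {k s : ℕ} → NFA k s → List (Fin k) → ℕ
#rej M x = countPaths M rej (NFA.q₀ M) (tape x)

record NFAFamily (k : ℕ) : Set where
  field
    size   : ℕ → ℕ
    M      : (n : ℕ) → NFA k (size n)
    polySz : PolyBounded size

record DFT (k s : ℕ) (Γ : Set) : Set where
  field
    δ  : Fin s → Sym k → Fin s × List Γ
    q₀ : Fin s

runDFT : {k s : ℕ} {Γ : Set} → DFT k s Γ → Fin s → List (Sym k) → List Γ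
runDFT T q []      = []
runDFT T q (a ∷ w) = proj₂ (DFT.δ T q a) ++ runDFT T (proj₁ (DFT.δ T q a)) w

outDFT : {k s : ℕ} {Γ : Set} → DFT k s Γ → List (Fin k) → List Γ
outDFT T x = runDFT T (DFT.q₀ T) (tape x)

record DFTFamily (k : ℕ) (Γ : Set) : Set where
  field
    size   : ℕ → ℕ
    T      : (n : ℕ) → DFT k (size n) Γ
    polySz : PolyBounded size

record PFamily (k : ℕ) (A : Set) : Set₁ where
  field
    D : ℕ → List (Fin k) → Set
    f : (n : ℕ) → (x : List (Fin k)) → D n x → A

IntFamily : ℕ → Set₁
IntFamily k = PFamily k ℤ

In1Sharp : {k : ℕ} → IntFamily k → Set
In1Sharp {k} F = Σ (NFAFamily k) λ 𝓜 →
  ∀ n x (d : PFamily.D F n x) →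
    PFamily.f F n x d ≡ + (#acc (NFAFamily.M 𝓜 n) x)

In1Gap : {k : ℕ} → IntFamily k → Set
In1Gap {k} F = Σ (NFAFamily k) λ 𝓜 →
  ∀ n x (d : PFamily.D F n x) →
    PFamily.f F n x d ≡ (+ #acc (NFAFamily.M 𝓜 n) x) - (+ #rej (NFAFamily.M 𝓜 n) x)

In1Gap≥0 : {k : ℕ} → IntFamily k → Set
In1Gap≥0 F = In1Gap F × (∀ n x (d : PFamily.D F n x) → PFamily.f F n x d ≥ + 0)

In1F : {k : ℕ} {Γ : Set} → PFamily k (List Γ) → Set
In1F {k} {Γ} F = Σ (DFTFamily k Γ) λ 𝓣 →
  ∀ n x (d : PFamily.D F n x) →
    outDFT (DFTFamily.T 𝓣 n) x ≡ PFamily.f F n x d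

-- binary representation (most significant bit first, true = 1);
-- bin k has a leading 1 for k > 0, bin 0 = [].
bitsLSB : ℕ → ℕ → List Bool   -- fuel, number
bitsLSB zero       m = []
bitsLSB (suc fuel) m =
  if m ≡ᵇ 0 then [] else ((m % 2) ≡ᵇ 1) ∷ bitsLSB fuel (m / 2)

bin : ℕ → List Bool
bin m = reverse (bitsLSB m m)

trans : ℤ → List Bool
trans (+ zero)   = []
trans (+ suc m)  = true ∷ bin (suc m)
trans -[1+ m ]   = false ∷ bin (suc m)

In1FZ : {k : ℕ} → IntFamily k → Set
In1FZ {k} F = In1F {k} {Bool} record
  { D = PFamily.D F
  ; f = λ n x d → trans (PFamily.f F n x d) }

{-# OPTIONS --safe #-}
module Submission where

-- Both separations are witnessed by the 1nfa that on aⁱbʲ has i accepting and j rejecting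
-- paths, so that its gap is i − j.
--
-- (1) Whether a 1nfa has some accepting path on u v depends on u only through the set of
-- states reachable after reading ▹ u.  There are finitely many such sets, so two prefixes aⁱ
-- and aʲ with i < j reach the same one; a 1nfa accepting aʲbⁱ would then also accept aⁱbⁱ,
-- so no 1nfa has exactly i ∸ j accepting paths on aⁱbʲ.
--
-- (2) On unary inputs aⁱ a 1dft eventually cycles through its states, so along an
-- arithmetic progression i = I + t p its output length is affine in t, whereas the length of
-- trans(i) = 1 bin(i) grows logarithmically.

open import Defs renaming (sym to letter)
open import Data.Bool using (Bool; true; false; T; if_then_else_)
open import Data.Bool.Properties using (T?; T-≡; if-cong)
open import Data.Fin using (Fin; zero; suc; _≟_; toℕ; combine)
open import Data.Fin.Properties using (any?; pigeonhole; combine-injective)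
open import Data.Fin.Subset using (Subset; _∈_; ⁅_⁆)
open import Data.Fin.Subset.Properties using (_∈?_; x∈⁅x⁆; x∈⁅y⁆⇒x≡y)
open import Data.Integer as ℤ using (_-_; +≤+)
open import Data.Integer.Properties using (+-injective; m-n≡m⊖n; ⊖-≥; i≤j⇒0≤j-i)
  renaming (+-identityʳ to ℤ-+-identityʳ)
open import Data.List using (List; []; _∷_; _++_; [_]; map; allFin; foldl; replicate; length)
open import Data.List.Properties using (foldl-++; map-++; ++-assoc; length-++; map-replicate; length-reverse)
import Data.List.Membership.Propositional as List
open import Data.List.Membership.Propositional.Properties using (∈-allFin)
open import Data.List.Relation.Unary.Any using (here; there)
open import Data.Nat using (ℕ; zero; suc; _+_; _*_; _^_; _<_; _≤_; _∸_; z≤n; s≤s)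
open import Data.Nat.DivMod using (_/_; _%_; m≡m%n+[m/n]*n; m%n<n; m/n<m; m/n*n≤m)
open import Data.Nat.ListAction using (sum)
open import Data.Nat.Properties
  using ( ≤-refl; ≤-trans; <⇒≤; <-irrefl; <-≤-trans; ≰⇒>; <⇒≱; <⇒≤pred; n<1+n; n≢0⇒n>0
        ; suc-injective; +-identityʳ; +-comm; +-assoc; *-comm; *-zeroʳ; n∸n≡0; m+[n∸m]≡n; m<n⇒0<n∸m
        ; m≤m+n; m≤n+m; m≤m*n; +-monoˡ-≤; +-monoʳ-≤; *-monoˡ-≤; *-monoʳ-≤; *-monoʳ-<; ^-monoʳ-≤
        ; module ≤-Reasoning )
open import Data.Nat.Tactic.RingSolver using (solve-∀)
open import Data.Product using (∃; ∃₂; _×_; _,_; proj₁; proj₂)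
open import Data.Unit using (⊤; tt)
open import Data.Vec using ([]; _∷_; tabulate)
open import Data.Vec.Properties using (lookup∘tabulate; []=⇒lookup; lookup⇒[]=)
open import Function using (_∘_)
open import Function.Bundles using (_⇔_; mk⇔; module Equivalence)
open import Relation.Binary.PropositionalEquality
  using (_≡_; _≢_; refl; cong; cong₂; subst; module ≡-Reasoning)
  renaming (sym to ≡-sym; trans to ≡-trans)
open import Relation.Nullary using (¬_)
open import Relation.Nullary.Decidable using (⌊_⌋; _×-dec_; toWitness; fromWitness)
open import Relation.Unary using (Pred; Decidable)

open Equivalence using (to; from)

+-∸ : ∀ {m n} → n ≤ m → ℤ.+ m - ℤ.+ n ≡ ℤ.+ (m ∸ n)
+-∸ {m} {n} n≤m = ≡-trans (m-n≡m⊖n m n) (⊖-≥ n≤m)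

replicate-+ : ∀ {A : Set} m n (x : A) → replicate (m + n) x ≡ replicate m x ++ replicate n x
replicate-+ zero    n x = refl
replicate-+ (suc m) n x = cong (x ∷_) (replicate-+ m n x)

sum-map-positive : {A : Set} (g : A → ℕ) (xs : List A) → 0 < sum (map g xs) → ∃ λ x → 0 < g x
sum-map-positive g (x ∷ xs) pos with g x in gx
... | suc _ = x , subst (0 <_) (≡-sym gx) (s≤s z≤n)
... | zero  = sum-map-positive g xs pos

≤-sum-map : {A : Set} (g : A → ℕ) {xs : List A} {x : A} → x List.∈ xs → g x ≤ sum (map g xs)
≤-sum-map g {y ∷ _} (here refl) = m≤m+n (g y) _
≤-sum-map g {y ∷ _} (there x∈xs) = ≤-trans (≤-sum-map g x∈xs) (m≤n+m _ (g y))

∈-tabulate-⌊⌋ : ∀ {n p} {P : Pred (Fin n) p} (P? : Decidable P) {i : Fin n} →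
                i ∈ tabulate (λ j → ⌊ P? j ⌋) ⇔ P i
∈-tabulate-⌊⌋ P? {i} = mk⇔
  (λ i∈ → toWitness (from T-≡ (≡-trans (≡-sym (lookup∘tabulate _ i)) ([]=⇒lookup i∈))))
  (λ Pi → lookup⇒[]= i _ (≡-trans (lookup∘tabulate _ i) (to T-≡ (fromWitness Pi))))

ℕ-pigeonhole : ∀ {m} (g : ℕ → Fin m) → ∃₂ λ i j → i < j × g i ≡ g j
ℕ-pigeonhole {m} g with i , j , i<j , gi≡gj ← pigeonhole (n<1+n m) (g ∘ toℕ) = toℕ i , toℕ j , i<j , gi≡gj

bit : Bool → Fin 2
bit false = zero
bit true  = suc zero

bit-injective : ∀ {b b′} → bit b ≡ bit b′ → b ≡ b′
bit-injective {false} {false} _ = refl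
bit-injective {true}  {true}  _ = refl

encodeSubset : ∀ {n} → Subset n → Fin (2 ^ n)
encodeSubset []      = zero
encodeSubset (b ∷ S) = combine (bit b) (encodeSubset S)

encodeSubset-injective : ∀ {n} {S S′ : Subset n} → encodeSubset S ≡ encodeSubset S′ → S ≡ S′
encodeSubset-injective {S = []}    {[]}      _ = refl
encodeSubset-injective {S = b ∷ S} {b′ ∷ S′} e
  with b≡b′ , S≡S′ ← combine-injective (bit b) (encodeSubset S) (bit b′) (encodeSubset S′) e =
  cong₂ _∷_ (bit-injective b≡b′) (encodeSubset-injective S≡S′)

subset-pigeonhole : ∀ {n} (g : ℕ → Subset n) → ∃₂ λ i j → i < j × g i ≡ g j
subset-pigeonhole g with i , j , i<j , e ← ℕ-pigeonhole (encodeSubset ∘ g) = i , j , i<j , encodeSubset-injective e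

tape-++ : ∀ {k} (u v : List (Fin k)) → tape (u ++ v) ≡ (▹ ∷ map letter u) ++ (map letter v ++ [ ◃ ])
tape-++ u v = cong (▹ ∷_) (≡-trans (cong (_++ [ ◃ ]) (map-++ letter u v)) (++-assoc (map letter u) (map letter v) [ ◃ ]))

module Reachable {k s : ℕ} (M : NFA k s) where
  open NFA M

  -- Accepting states are made to loop and rejecting states to die, so that a set of states is
  -- alive on c ∷ w exactly when its successor set is alive on w.
  edge : Fin s → Sym k → Fin s → Bool
  edge q c q′ with kind q
  ... | acc = ⌊ q ≟ q′ ⌋
  ... | rej = false
  ... | run = δ q c q′

  edge-acc : ∀ {q c} → kind q ≡ acc → T (edge q c q)
  edge-acc {q} e rewrite e = fromWitness refl

  edge-run : ∀ {q c q′} → kind q ≡ run → T (δ q c q′) → T (edge q c q′)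
  edge-run e d rewrite e = d

  post : Subset s → Sym k → Subset s
  post S c = tabulate λ q′ → ⌊ any? (λ q → q ∈? S ×-dec T? (edge q c q′)) ⌋

  post⁺ : ∀ {S c q q′} → q ∈ S → T (edge q c q′) → q′ ∈ post S c
  post⁺ q∈S e = from (∈-tabulate-⌊⌋ _) (_ , q∈S , e)

  post⁻ : ∀ {S c q′} → q′ ∈ post S c → ∃ λ q → q ∈ S × T (edge q c q′)
  post⁻ = to (∈-tabulate-⌊⌋ _)

  count-acc : ∀ {q w} → kind q ≡ acc → countPaths M acc q w ≡ 1
  count-acc e rewrite e = refl

  count-run : ∀ {q c w} → kind q ≡ run →
              countPaths M acc q (c ∷ w) ≡ sum (map (λ q′ → if δ q c q′ then countPaths M acc q′ w else 0) (allFin s))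
  count-run e rewrite e = refl

  Alive : Subset s → List (Sym k) → Set
  Alive S w = ∃ λ q → q ∈ S × 0 < countPaths M acc q w

  post* : Subset s → List (Sym k) → Subset s
  post* = foldl post

  alive-post : ∀ {S c w} → Alive S (c ∷ w) → Alive (post S c) w
  alive-post {c = c} {w} (q , q∈S , pos) with kind q in kq
  ... | acc = q , post⁺ q∈S (edge-acc kq) , subst (0 <_) (≡-sym (count-acc kq)) (s≤s z≤n)
  ... | run with q′ , pos′ ← sum-map-positive _ (allFin s) pos with δ q c q′ in d
  ...   | true = q′ , post⁺ q∈S (edge-run kq (from T-≡ d)) , pos′

  alive-pre : ∀ {S c w} → Alive (post S c) w → Alive S (c ∷ w)
  alive-pre {c = c} {w} (q′ , q′∈ , pos) with q , q∈S , e ← post⁻ q′∈ with kind q in kq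
  ... | acc = q , q∈S , subst (0 <_) (≡-sym (count-acc kq)) (s≤s z≤n)
  ... | run = q , q∈S , subst (0 <_) (≡-sym (count-run kq)) (<-≤-trans pos′ (≤-sum-map _ (∈-allFin q′)))
    where
      pos′ : 0 < (if δ q c q′ then countPaths M acc q′ w else 0)
      pos′ = subst (0 <_) (≡-sym (if-cong (to T-≡ e))) pos

  alive-++⇔ : ∀ {S} u {w} → Alive S (u ++ w) ⇔ Alive (post* S u) w
  alive-++⇔ []      = mk⇔ (λ alive → alive) (λ alive → alive)
  alive-++⇔ (c ∷ u) = mk⇔ (to (alive-++⇔ u) ∘ alive-post)
                          (alive-pre ∘ from (alive-++⇔ u))

  positive⇔alive-⁅⁆ : ∀ {q w} → 0 < countPaths M acc q w ⇔ Alive ⁅ q ⁆ w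
  positive⇔alive-⁅⁆ {q} = mk⇔
    (λ pos → q , x∈⁅x⁆ q , pos)
    (λ { (q′ , q′∈ , pos) → subst (λ r → 0 < countPaths M acc r _) (x∈⁅y⁆⇒x≡y q q′∈) pos })

  reachable : List (Fin k) → Subset s
  reachable u = post* ⁅ q₀ ⁆ (▹ ∷ map letter u)

  #acc-positive⇔alive : ∀ u v → 0 < #acc M (u ++ v) ⇔ Alive (reachable u) (map letter v ++ [ ◃ ])
  #acc-positive⇔alive u v = mk⇔
    (λ pos → to (alive-++⇔ (▹ ∷ map letter u)) (to positive⇔alive-⁅⁆ (subst positive (tape-++ u v) pos)))
    (λ alive → subst positive (≡-sym (tape-++ u v))
                 (from positive⇔alive-⁅⁆ (from (alive-++⇔ (▹ ∷ map letter u)) alive)))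
    where
      positive : List (Sym k) → Set
      positive w = 0 < countPaths M acc q₀ w

  #acc-positive-respects-reachable : ∀ {u u′} v → reachable u ≡ reachable u′ →
                                     0 < #acc M (u ++ v) → 0 < #acc M (u′ ++ v)
  #acc-positive-respects-reachable {u} {u′} v same =
    from (#acc-positive⇔alive u′ v) ∘ subst (λ S → Alive S _) same ∘ to (#acc-positive⇔alive u v)

accepts-balanced-word : ∀ {k s} (M : NFA k s) (a b : Fin k) →
  (∀ i j → i < j → 0 < #acc M (replicate j a ++ replicate i b)) →
  ∃ λ i → 0 < #acc M (replicate i a ++ replicate i b)
accepts-balanced-word M a b unbalanced
  with i , j , i<j , same ← subset-pigeonhole (λ n → Reachable.reachable M (replicate n a)) =
  i , Reachable.#acc-positive-respects-reachable M (replicate i b) (≡-sym same) (unbalanced i j i<j)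

no-nfa-counts-difference : ∀ {k s} (M : NFA k s) (a b : Fin k) →
  ¬ (∀ i j → j ≤ i → #acc M (replicate i a ++ replicate j b) ≡ i ∸ j)
no-nfa-counts-difference M a b counts
  with i , accepted ← accepts-balanced-word M a b
         (λ i j i<j → subst (0 <_) (≡-sym (counts j i (<⇒≤ i<j))) (m<n⇒0<n∸m i<j)) =
  <-irrefl (≡-sym (≡-trans (counts i i ≤-refl) (n∸n≡0 i))) accepted

module _ {k s : ℕ} {Γ : Set} (T : DFT k s Γ) where
  open DFT T

  endState : Fin s → List (Sym k) → Fin s
  endState = foldl (λ q c → proj₁ (δ q c))

  runDFT-++ : ∀ q u w → runDFT T q (u ++ w) ≡ runDFT T q u ++ runDFT T (endState q u) w
  runDFT-++ q []      w = refl
  runDFT-++ q (c ∷ u) w = ≡-trans (cong (proj₂ (δ q c) ++_) (runDFT-++ (proj₁ (δ q c)) u w))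
                                  (≡-sym (++-assoc (proj₂ (δ q c)) _ _))

  endState-++ : ∀ q u w → endState q (u ++ w) ≡ endState (endState q u) w
  endState-++ = foldl-++ _

  length-runDFT-++ : ∀ q u w → length (runDFT T q (u ++ w)) ≡ length (runDFT T q u) + length (runDFT T (endState q u) w)
  length-runDFT-++ q u w = ≡-trans (cong length (runDFT-++ q u w)) (length-++ (runDFT T q u))

  module _ {x : Sym k} {p : ℕ} {q : Fin s} (cycle : endState q (replicate p x) ≡ q) where

    endState-cycle : ∀ t → endState q (replicate (t * p) x) ≡ q
    endState-cycle zero    = refl
    endState-cycle (suc t) = begin
      endState q (replicate (p + t * p) x)                        ≡⟨ cong (endState q) (replicate-+ p (t * p) x) ⟩
      endState q (replicate p x ++ replicate (t * p) x)           ≡⟨ endState-++ q (replicate p x) _ ⟩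
      endState (endState q (replicate p x)) (replicate (t * p) x) ≡⟨ cong (λ r → endState r (replicate (t * p) x)) cycle ⟩
      endState q (replicate (t * p) x)                            ≡⟨ endState-cycle t ⟩
      q                                                           ∎
      where open ≡-Reasoning

    length-runDFT-cycle : ∀ t → length (runDFT T q (replicate (t * p) x)) ≡ t * length (runDFT T q (replicate p x))
    length-runDFT-cycle zero    = refl
    length-runDFT-cycle (suc t) = begin
      length (runDFT T q (replicate (p + t * p) x))              ≡⟨ cong (length ∘ runDFT T q) (replicate-+ p (t * p) x) ⟩
      length (runDFT T q (replicate p x ++ replicate (t * p) x)) ≡⟨ length-runDFT-++ q (replicate p x) _ ⟩
      ℓ + length (runDFT T (endState q (replicate p x)) (replicate (t * p) x))
                                                                 ≡⟨ cong (λ r → ℓ + length (runDFT T r (replicate (t * p) x))) cycle ⟩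
      ℓ + length (runDFT T q (replicate (t * p) x))              ≡⟨ cong (ℓ +_) (length-runDFT-cycle t) ⟩
      ℓ + t * ℓ                                                  ∎
      where open ≡-Reasoning
            ℓ = length (runDFT T q (replicate p x))

  module _ (c : Fin k) where

    prefix : ℕ → List (Sym k)
    prefix n = ▹ ∷ replicate n (letter c)

    tape-replicate-++ : ∀ n v → tape (replicate n c ++ v) ≡ prefix n ++ (map letter v ++ [ ◃ ])
    tape-replicate-++ n v = ≡-trans (tape-++ (replicate n c) v) (cong (λ u → (▹ ∷ u) ++ _) (map-replicate letter n c))

    length-outDFT-periodic : ∀ I p → endState q₀ (prefix (I + p)) ≡ endState q₀ (prefix I) → ∀ v →
      ∃₂ λ α β → ∀ t → length (outDFT T (replicate (I + t * p) c ++ v)) ≡ α + t * β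
    length-outDFT-periodic I p same v = A + E , B , length≡
      where
        open ≡-Reasoning
        x = letter c
        w = map letter v ++ [ ◃ ]
        Q = endState q₀ (prefix I)
        A = length (runDFT T q₀ (prefix I))
        B = length (runDFT T Q (replicate p x))
        E = length (runDFT T Q w)

        cycle : endState Q (replicate p x) ≡ Q
        cycle = begin
          endState Q (replicate p x)              ≡⟨ endState-++ q₀ (prefix I) (replicate p x) ⟨
          endState q₀ (prefix I ++ replicate p x) ≡⟨ cong (λ u → endState q₀ (▹ ∷ u)) (replicate-+ I p x) ⟨
          endState q₀ (prefix (I + p))            ≡⟨ same ⟩
          Q                                       ∎

        split : ∀ t → replicate (I + t * p) x ++ w ≡ replicate I x ++ (replicate (t * p) x ++ w)
        split t = ≡-trans (cong (_++ w) (replicate-+ I (t * p) x)) (++-assoc (replicate I x) _ w)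

        length≡ : ∀ t → length (outDFT T (replicate (I + t * p) c ++ v)) ≡ (A + E) + t * B
        length≡ t = begin
          length (outDFT T (replicate (I + t * p) c ++ v))              ≡⟨ cong (length ∘ runDFT T q₀) (tape-replicate-++ (I + t * p) v) ⟩
          length (runDFT T q₀ (prefix (I + t * p) ++ w))                ≡⟨ cong (λ u → length (runDFT T q₀ (▹ ∷ u))) (split t) ⟩
          length (runDFT T q₀ (prefix I ++ (replicate (t * p) x ++ w))) ≡⟨ length-runDFT-++ q₀ (prefix I) _ ⟩
          A + length (runDFT T Q (replicate (t * p) x ++ w))            ≡⟨ cong (A +_) (length-runDFT-++ Q (replicate (t * p) x) w) ⟩
          A + (length (runDFT T Q (replicate (t * p) x)) + length (runDFT T (endState Q (replicate (t * p) x)) w))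
            ≡⟨ cong₂ (λ m r → A + (m + length (runDFT T r w))) (length-runDFT-cycle cycle t) (endState-cycle cycle t) ⟩
          A + (t * B + E)                                               ≡⟨ cong (A +_) (+-comm (t * B) E) ⟩
          A + (E + t * B)                                               ≡⟨ +-assoc A E (t * B) ⟨
          (A + E) + t * B                                               ∎

    length-outDFT-eventually-affine : ∀ v → ∃₂ λ I p → 0 < p × ∃₂ λ α β →
      ∀ t → length (outDFT T (replicate (I + t * p) c ++ v)) ≡ α + t * β
    length-outDFT-eventually-affine v with I , J , I<J , same ← ℕ-pigeonhole (endState q₀ ∘ prefix) =
      I , J ∸ I , m<n⇒0<n∸m I<J ,
      length-outDFT-periodic I (J ∸ I) (≡-trans (cong (endState q₀ ∘ prefix) (m+[n∸m]≡n (<⇒≤ I<J))) (≡-sym same)) v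

2^-cancel-< : ∀ {m n} → 2 ^ m < 2 ^ n → m < n
2^-cancel-< lt = ≰⇒> λ n≤m → <⇒≱ lt (^-monoʳ-≤ 2 n≤m)

length-bitsLSB-0 : ∀ f → length (bitsLSB f 0) ≡ 0
length-bitsLSB-0 zero    = refl
length-bitsLSB-0 (suc f) = refl

<2^length-bitsLSB : ∀ f m → m ≤ f → m < 2 ^ length (bitsLSB f m)
<2^length-bitsLSB f       zero    _ rewrite length-bitsLSB-0 f = s≤s z≤n
<2^length-bitsLSB (suc f) (suc m) (s≤s m≤f) = begin-strict
  suc m                 ≡⟨ m≡m%n+[m/n]*n (suc m) 2 ⟩
  suc m % 2 + half * 2  ≤⟨ +-monoˡ-≤ (half * 2) (<⇒≤pred (m%n<n (suc m) 2)) ⟩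
  1 + half * 2          <⟨ n<1+n (1 + half * 2) ⟩
  suc half * 2          ≤⟨ *-monoˡ-≤ 2 (<2^length-bitsLSB f half (≤-trans half≤m m≤f)) ⟩
  2 ^ L * 2             ≡⟨ *-comm (2 ^ L) 2 ⟩
  2 * 2 ^ L             ∎
  where
    open ≤-Reasoning
    half = suc m / 2
    L = length (bitsLSB f half)
    half≤m : half ≤ m
    half≤m = <⇒≤pred (m/n<m (suc m) 2 (s≤s (s≤s z≤n)))

2^length-bitsLSB≤ : ∀ f m → 1 ≤ m → 2 ^ length (bitsLSB f m) ≤ 2 * m
2^length-bitsLSB≤ zero    (suc m) _ = s≤s z≤n
2^length-bitsLSB≤ (suc f) (suc m) _ = *-monoʳ-≤ 2 (bound (suc m / 2) (m/n*n≤m (suc m) 2))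
  where
    bound : ∀ h → h * 2 ≤ suc m → 2 ^ length (bitsLSB f h) ≤ suc m
    bound zero    _   rewrite length-bitsLSB-0 f = s≤s z≤n
    bound (suc h) h*2≤m = ≤-trans (2^length-bitsLSB≤ f (suc h) (s≤s z≤n)) (subst (_≤ suc m) (*-comm (suc h) 2) h*2≤m)

length-bin : ∀ m → length (bin m) ≡ length (bitsLSB m m)
length-bin m = length-reverse (bitsLSB m m)

<2^length-bin : ∀ m → m < 2 ^ length (bin m)
<2^length-bin m rewrite length-bin m = <2^length-bitsLSB m m ≤-refl

2^length-bin≤ : ∀ {m} → 1 ≤ m → 2 ^ length (bin m) ≤ 2 * m
2^length-bin≤ {m} 1≤m rewrite length-bin m = 2^length-bitsLSB≤ m m 1≤m

length-bin-doubling : ∀ {m n} → 1 ≤ m → 2 * m ≤ n → length (bin m) < length (bin n)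
length-bin-doubling {m} {n} 1≤m 2m≤n = 2^-cancel-< (begin-strict
  2 ^ length (bin m) ≤⟨ 2^length-bin≤ 1≤m ⟩
  2 * m              ≤⟨ 2m≤n ⟩
  n                  <⟨ <2^length-bin n ⟩
  2 ^ length (bin n) ∎)
  where open ≤-Reasoning

length-bin-≤4* : ∀ {m n} → 1 ≤ n → n ≤ 4 * m → length (bin n) < 3 + length (bin m)
length-bin-≤4* {m} {n} 1≤n n≤4m = 2^-cancel-< (begin-strict
  2 ^ length (bin n)           ≤⟨ 2^length-bin≤ 1≤n ⟩
  2 * n                        ≤⟨ *-monoʳ-≤ 2 n≤4m ⟩
  2 * (4 * m)                  <⟨ *-monoʳ-< 2 (*-monoʳ-< 4 (<2^length-bin m)) ⟩
  2 * (4 * 2 ^ length (bin m)) ≡⟨ eight (2 ^ length (bin m)) ⟩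
  2 ^ (3 + length (bin m))     ∎)
  where
    open ≤-Reasoning
    eight : ∀ x → 2 * (4 * x) ≡ 2 * (2 * (2 * x))
    eight = solve-∀

length-trans : ∀ {m} → 1 ≤ m → length (trans (ℤ.+ m)) ≡ suc (length (bin m))
length-trans {suc m} _ = refl

-- Along the progression m t = I + t (1 + p′) the bit length L t grows, but only logarithmically:
-- slope 0 contradicts L 1 < L (2 m 1), and a positive slope contradicts L 4 < 3 + L 1.
module _ {I p′ α β : ℕ} (affine : ∀ t → length (trans (ℤ.+ (I + t * suc p′))) ≡ α + t * β) where
  private
    m : ℕ → ℕ
    m t = I + t * suc p′

    L : ℕ → ℕ
    L t = length (bin (m t))

    ≤m : ∀ t → t ≤ m t
    ≤m t = ≤-trans (m≤m*n t (suc p′)) (m≤n+m (t * suc p′) I)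

    affine-L : ∀ t → 1 ≤ t → suc (L t) ≡ α + t * β
    affine-L t 1≤t = ≡-trans (≡-sym (length-trans (≤-trans 1≤t (≤m t)))) (affine t)

  affine-slope≢0 : β ≢ 0
  affine-slope≢0 refl = <-irrefl L₁≡L₂ₘ (length-bin-doubling (≤m 1) (≤m (2 * m 1)))
    where
      L₁≡L₂ₘ : L 1 ≡ L (2 * m 1)
      L₁≡L₂ₘ = suc-injective (begin
        suc (L 1)         ≡⟨ affine-L 1 (s≤s z≤n) ⟩
        α + 1 * 0         ≡⟨ cong (λ x → α + x) (≡-trans (*-zeroʳ 1) (≡-sym (*-zeroʳ (2 * m 1)))) ⟩
        α + 2 * m 1 * 0   ≡⟨ affine-L (2 * m 1) (≤-trans (s≤s z≤n) (*-monoʳ-≤ 2 (≤m 1))) ⟨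
        suc (L (2 * m 1)) ∎)
        where open ≡-Reasoning

  affine-slope≯0 : ¬ (0 < β)
  affine-slope≯0 0<β = <⇒≱ (length-bin-≤4* {m 1} {m 4} (≤-trans (s≤s z≤n) (≤m 4)) m₄≤4m₁) 3+L₁≤L₄
    where
      L₄≡L₁+3β : L 4 ≡ L 1 + 3 * β
      L₄≡L₁+3β = suc-injective (begin
        suc (L 4)                     ≡⟨ affine-L 4 (s≤s z≤n) ⟩
        α + 4 * β                     ≡⟨ shift α β ⟩
        (α + 1 * β) + 3 * β           ≡⟨ cong (_+ 3 * β) (affine-L 1 (s≤s z≤n)) ⟨
        suc (L 1) + 3 * β             ∎)
        where
          open ≡-Reasoning
          shift : ∀ α β → α + 4 * β ≡ (α + 1 * β) + 3 * β
          shift = solve-∀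
      3+L₁≤L₄ : 3 + L 1 ≤ L 4
      3+L₁≤L₄ = subst (3 + L 1 ≤_) (≡-sym L₄≡L₁+3β)
                  (subst (_≤ L 1 + 3 * β) (+-comm (L 1) 3) (+-monoʳ-≤ (L 1) (*-monoʳ-≤ 3 0<β)))
      m₄≤4m₁ : m 4 ≤ 4 * m 1
      m₄≤4m₁ = subst (m 4 ≤_) (≡-sym (spread I p′)) (m≤m+n (m 4) (3 * I))
        where
          spread : ∀ I p′ → 4 * (I + 1 * suc p′) ≡ (I + 4 * suc p′) + 3 * I
          spread = solve-∀

length-trans-not-affine : ∀ {I p α β : ℕ} → 0 < p → ¬ (∀ t → length (trans (ℤ.+ (I + t * p))) ≡ α + t * β)
length-trans-not-affine {I} {suc p′} {α} {β} _ affine =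
  affine-slope≯0 {I} {p′} {α} {β} affine (n≢0⇒n>0 (affine-slope≢0 {I} {p′} {α} {β} affine))

no-dft-encodes-unary-length : ∀ {k s} (T : DFT k s Bool) (c : Fin k) v →
  ¬ (∀ i → outDFT T (replicate i c ++ v) ≡ trans (ℤ.+ i))
no-dft-encodes-unary-length T c v encodes
  with I , p , 0<p , α , β , affine ← length-outDFT-eventually-affine T c v =
  length-trans-not-affine {I} {p} {α} {β} 0<p λ t → ≡-trans (cong length (≡-sym (encodes (I + t * p)))) (affine t)

pattern a = zero
pattern b = suc zero

aⁱbʲ : ℕ → ℕ → List (Fin 2)
aⁱbʲ i j = replicate i a ++ replicate j b

pattern start  = zero
pattern scan   = suc zero
pattern accept = suc (suc zero)
pattern reject = suc (suc (suc zero))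

counter : NFA 2 4
counter = record { kind = kind ; δ = δ ; q₀ = start }
  where
    kind : Fin 4 → Kind
    kind accept = acc
    kind reject = rej
    kind _      = run

    δ : Fin 4 → Sym 2 → Fin 4 → Bool
    δ start ▹            scan   = true
    δ scan  (letter a)   scan   = true
    δ scan  (letter a)   accept = true
    δ scan  (letter b)   scan   = true
    δ scan  (letter b)   reject = true
    δ _     _            _      = false

scan-acc : ∀ i j → countPaths counter acc scan (map letter (aⁱbʲ i j) ++ [ ◃ ]) ≡ i
scan-acc zero    zero    = refl
scan-acc zero    (suc j) = ≡-trans (+-identityʳ _) (scan-acc zero j)
scan-acc (suc i) j       = ≡-trans (+-comm _ 1) (cong suc (scan-acc i j))

#acc-counter : ∀ i j → #acc counter (aⁱbʲ i j) ≡ i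
#acc-counter i j = ≡-trans (+-identityʳ _) (scan-acc i j)

scan-rej : ∀ i j → countPaths counter rej scan (map letter (aⁱbʲ i j) ++ [ ◃ ]) ≡ j
scan-rej zero    zero    = refl
scan-rej zero    (suc j) = ≡-trans (+-comm _ 1) (cong suc (scan-rej zero j))
scan-rej (suc i) j       = ≡-trans (+-identityʳ _) (scan-rej i j)

#rej-counter : ∀ i j → #rej counter (aⁱbʲ i j) ≡ j
#rej-counter i j = ≡-trans (+-identityʳ _) (scan-rej i j)

constantFamily : ∀ {k s} → NFA k s → NFAFamily k
constantFamily {s = s} M = record
  { size = λ _ → s ; M = λ _ → M ; polySz = (s ∷ []) , λ n → m≤m+n s (n * 0) }

differenceFamily : (ℕ → ℕ → Set) → IntFamily 2
differenceFamily R = record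
  { D = λ _ x → ∃₂ λ i j → R i j × x ≡ aⁱbʲ i j
  ; f = λ { _ _ (i , j , _) → ℤ.+ i - ℤ.+ j } }

differenceFamily∈1Gap : ∀ R → In1Gap (differenceFamily R)
differenceFamily∈1Gap R = constantFamily counter , λ { _ _ (i , j , _ , refl) →
  cong₂ (λ m n → ℤ.+ m - ℤ.+ n) (≡-sym (#acc-counter i j)) (≡-sym (#rej-counter i j)) }

nonnegativeDifference : IntFamily 2
nonnegativeDifference = differenceFamily λ i j → j ≤ i

nonnegativeDifference∈1Gap≥0 : In1Gap≥0 nonnegativeDifference
nonnegativeDifference∈1Gap≥0 =
  differenceFamily∈1Gap _ , λ { _ _ (i , j , j≤i , refl) → i≤j⇒0≤j-i (+≤+ j≤i) }

1Sharp≢1Gap≥0 : ¬ (∀ k (F : IntFamily k) → In1Sharp F ⇔ In1Gap≥0 F)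
1Sharp≢1Gap≥0 equal =
  let (𝓜 , computes) = from (equal 2 nonnegativeDifference) nonnegativeDifference∈1Gap≥0
  in no-nfa-counts-difference (NFAFamily.M 𝓜 0) a b λ i j j≤i →
       +-injective (≡-trans (≡-sym (computes 0 _ (i , j , j≤i , refl))) (+-∸ j≤i))

1FZ≢1Gap : ¬ (∀ k (F : IntFamily k) → In1FZ F ⇔ In1Gap F)
1FZ≢1Gap equal =
  let (𝓣 , computes) = from (equal 2 (differenceFamily λ _ _ → ⊤)) (differenceFamily∈1Gap _)
  in no-dft-encodes-unary-length (DFTFamily.T 𝓣 0) a [] λ i →
       ≡-trans (computes 0 _ (i , 0 , tt , refl)) (cong trans (ℤ-+-identityʳ (ℤ.+ i)))

proposition4p15 :
    (¬ (∀ (k : ℕ) (F : IntFamily k) → (In1Sharp F ⇔ In1Gap≥0 F)))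
    × (¬ (∀ (k : ℕ) (F : IntFamily k) → (In1FZ F ⇔ In1Gap F)))
proposition4p15 = 1Sharp≢1Gap≥0 , 1FZ≢1Gap
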